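{- Let $H\le F_n$ be a finitely generated subgroup, let $X_n$ be the wedge of $n$ circles, and let $f:X\to X_n$ be a graph immersion from a connected graph $X$ with $f_*(\pi_1(X))=H$. Then $H$ is closed under square roots in $F_n$ if and only if for any two distinct vertices $x_1,x_2$ of $X$, the vertices $(x_1,x_2)$ and $(x_2,x_1)$ lie in different connected components of the fiber product $X\otimes_{X_n}X$.
   Context: Graphs are $1$-dimensional CW complexes; a morphism of graphs is a cellular map sending each open edge homeomorphically onto an open edge; an immersion is a locally injective morphism. $\pi_1(X_n)$ is identified with $F_n$. For graph morphisms $A\to Y$, $B\to Y$, the fiber product $A\otimes_Y B$ is the graph whose vertices (resp. edges) are pairs of vertices (resp. edges) of $A$ and $B$ with the same image in $Y$. A subgroup $H\le G$ is closed under square roots if $g^2\in H$ implies $g\in H$ for all $g\in G$. -}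

module Defs where

open import Data.Nat using (ℕ)
open import Data.Fin using (Fin)
open import Data.Bool using (Bool; not; true; false)
open import Data.Product using (Σ; ∃; _×_; _,_; proj₁; proj₂)
open import Data.List using (List; []; _∷_; _++_; reverse; map)
open import Data.List.Membership.Propositional using (_∈_)
open import Relation.Binary.PropositionalEquality using (_≡_; _≢_)
open import Relation.Binary.Construct.Closure.Equivalence using (EqClosure)
open import Relation.Nullary using (¬_)
open import Function.Bundles using (_⇔_)

-- The free group F_n on generators Fin n, as words modulo free reduction.

-- A letter is a generator together with an exponent sign (true = a, false = a⁻¹).
Letter : ℕ → Set
Letter n = Fin n × Bool

invL : ∀ {n} → Letter n → Letter n
invL (a , s) = (a , not s)

Word : ℕ → Set
Word n = List (Letter n)

invW : ∀ {n} → Word n → Word n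
invW w = reverse (map invL w)

data Cancel {n : ℕ} : Word n → Word n → Set where
  cancel : (u v : Word n) (x : Letter n) → Cancel (u ++ (x ∷ invL x ∷ v)) (u ++ v)

_≈w_ : ∀ {n} → Word n → Word n → Set
_≈w_ = EqClosure Cancel

record IsSubgroup {n : ℕ} (H : Word n → Set) : Set where
  field
    resp  : ∀ {u v} → u ≈w v → H u → H v
    ε∈    : H []
    ∙-closed : ∀ {u v} → H u → H v → H (u ++ v)
    ⁻¹-closed : ∀ {u} → H u → H (invW u)

data Generated {n : ℕ} (gs : List (Word n)) : Word n → Set where
  gen-ε   : Generated gs []
  gen-mul : ∀ {g w} → g ∈ gs → Generated gs w → Generated gs (g ++ w)
  gen-inv : ∀ {g w} → g ∈ gs → Generated gs w → Generated gs (invW g ++ w)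
  gen-≈   : ∀ {u v} → u ≈w v → Generated gs u → Generated gs v

FinitelyGenerated : ∀ {n} → (Word n → Set) → Set
FinitelyGenerated {n} H = Σ (List (Word n)) λ gs → ∀ w → H w ⇔ Generated gs w

SqrtClosed : ∀ {n} → (Word n → Set) → Set
SqrtClosed H = ∀ g → H (g ++ g) → H g

-- A graph morphism X → X_n is encoded by a labelling of the (oriented)
-- edges of X by the n edges of X_n, each edge of X being oriented
-- compatibly with the orientation of its image.

record LGraph (n : ℕ) : Set₁ where
  field
    V E   : Set
    ι τ   : E → V
    label : E → Fin n
open LGraph public

IsImmersion : ∀ {n} → LGraph n → Set
IsImmersion X =
  (∀ e e' → ι X e ≡ ι X e' → label X e ≡ label X e' → e ≡ e') ×
  (∀ e e' → τ X e ≡ τ X e' → label X e ≡ label X e' → e ≡ e')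

data Path {n : ℕ} (X : LGraph n) : V X → V X → Set where
  nil : ∀ {x} → Path X x x
  fwd : ∀ {y} (e : E X) → Path X (τ X e) y → Path X (ι X e) y
  bwd : ∀ {y} (e : E X) → Path X (ι X e) y → Path X (τ X e) y

pathLabel : ∀ {n} {X : LGraph n} {x y} → Path X x y → Word n
pathLabel nil = []
pathLabel {X = X} (fwd e p) = (label X e , true) ∷ pathLabel p
pathLabel {X = X} (bwd e p) = (label X e , false) ∷ pathLabel p

Connected : ∀ {n} → LGraph n → Set
Connected X = ∀ x y → Path X x y

InImage : ∀ {n} (X : LGraph n) → V X → Word n → Set
InImage X x₀ w = Σ (Path X x₀ x₀) λ p → pathLabel p ≈w w

_⊗_ : ∀ {n} → LGraph n → LGraph n → LGraph n
A ⊗ B = record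
  { V = V A × V B
  ; E = Σ (E A × E B) λ ee → label A (proj₁ ee) ≡ label B (proj₂ ee)
  ; ι = λ ee → (ι A (proj₁ (proj₁ ee)) , ι B (proj₂ (proj₁ ee)))
  ; τ = λ ee → (τ A (proj₁ (proj₁ ee)) , τ B (proj₂ (proj₁ ee)))
  ; label = λ ee → label A (proj₁ (proj₁ ee))
  }

module Submission where

-- X is folded (an immersion), so walks from one vertex whose labels are equal
-- in F_n end at the same vertex; paths of X ⊗ X are pairs of equally
-- labelled walks of X.
-- (⇒) A path (x₁ , x₂) → (x₂ , x₁) gives walks x₁ → x₂ → x₁ labelled w w;
-- for c : x₀ → x₁ the element g = c w c⁻¹ has g² ∈ H, so g ∈ H, and reading
-- c w from x₀ directly or after a loop for g forces x₁ = x₂.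
-- (⇐) Write g = u h u⁻¹ with h cyclically reduced.  The reduced loop for g²
-- reads u h h u⁻¹ through y (after u) and z (after u h); its h-segments form
-- a path (y , z) → (z , y), so y = z and u h u⁻¹ labels a loop.  This case
-- split needs y ≡ z to be decidable: Stallings folding of the finite walk
-- formed by the generator loops and the relevant paths decides it.

open import Defs
open import Data.Empty using (⊥-elim)
open import Data.Unit using (⊤)
open import Data.Bool using (Bool; true; false; not)
import Data.Bool.Properties as Boolₚ
import Data.Fin.Properties as Finₚ
open import Data.Nat using (ℕ; zero; suc; _≤_; _<_; z≤n; s≤s; s≤s⁻¹; _+_; _≟_)
open import Data.Nat.Properties
  using (≤-refl; ≤-trans; <⇒≤; ≤∧≢⇒<; <-≤-trans; ≤-<-trans; <-irrefl; <-cmp; m≤n⇒m≤1+n; n≤1+n; +-suc; +-identityʳ)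
open import Data.Product using (Σ; _×_; _,_; proj₁; proj₂)
import Data.Product.Properties as Productₚ
open import Data.Sum using (_⊎_; inj₁; inj₂)
open import Data.List using (List; []; _∷_; _++_; [_]; reverse; map; foldr; length)
open import Data.List.Properties
  using (++-assoc; ++-identityʳ; ∷-injective; unfold-reverse; reverse-++; map-++; foldr-++; length-++-≤ˡ)
open import Data.List.Membership.Propositional using (_∈_; find; lose)
open import Data.List.Membership.Propositional.Properties using (∈-++⁺ˡ; ∈-++⁺ʳ)
open import Data.List.Relation.Unary.Any using (here; there; any?)
open import Data.List.Relation.Unary.All using (All; []; _∷_; tabulate)
open import Relation.Binary.Definitions using (DecidableEquality; tri<; tri≈; tri>)
open import Relation.Binary.PropositionalEquality hiding ([_])
open import Relation.Binary.Construct.Closure.ReflexiveTransitive using (ε; _◅◅_)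
import Relation.Binary.Construct.Closure.Equivalence as EqClosure
import Relation.Binary.Reasoning.Setoid as SetoidReasoning
open import Relation.Nullary using (¬_; Dec; yes; no)
open import Relation.Nullary.Decidable using (_×-dec_; ¬?; map′)
open import Function.Base using (_∘_)
open import Function.Bundles using (_⇔_; mk⇔; Equivalence)

open Equivalence using (to; from)

module FreeGroup {n : ℕ} where

  ≈w-sym : ∀ {u v : Word n} → u ≈w v → v ≈w u
  ≈w-sym = EqClosure.symmetric Cancel

  ≈w-reflexive : ∀ {u v : Word n} → u ≡ v → u ≈w v
  ≈w-reflexive refl = ε

  module ≈w-Reasoning = SetoidReasoning (EqClosure.setoid (Cancel {n}))

  _≟L_ : DecidableEquality (Letter n)
  _≟L_ = Productₚ.≡-dec Finₚ._≟_ Boolₚ._≟_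

  invL-involutive : (x : Letter n) → invL (invL x) ≡ x
  invL-involutive (a , true) = refl
  invL-involutive (a , false) = refl

  invL-≢ : (x : Letter n) → x ≢ invL x
  invL-≢ (a , true) ()
  invL-≢ (a , false) ()

  cancel-++ˡ : ∀ w {u v : Word n} → Cancel u v → Cancel (w ++ u) (w ++ v)
  cancel-++ˡ w (cancel a b x) =
    subst₂ Cancel (++-assoc w a (x ∷ invL x ∷ b)) (++-assoc w a b) (cancel (w ++ a) b x)

  cancel-++ʳ : ∀ w {u v : Word n} → Cancel u v → Cancel (u ++ w) (v ++ w)
  cancel-++ʳ w (cancel a b x) =
    subst₂ Cancel (sym (++-assoc a (x ∷ invL x ∷ b) w)) (sym (++-assoc a b w)) (cancel a (b ++ w) x)

  ≈w-++ˡ : ∀ w {u v : Word n} → u ≈w v → (w ++ u) ≈w (w ++ v)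
  ≈w-++ˡ w = EqClosure.gmap (w ++_) (cancel-++ˡ w)

  ≈w-++ʳ : ∀ w {u v : Word n} → u ≈w v → (u ++ w) ≈w (v ++ w)
  ≈w-++ʳ w = EqClosure.gmap (_++ w) (cancel-++ʳ w)

  ≈w-++ : ∀ {u u' v v' : Word n} → u ≈w u' → v ≈w v' → (u ++ v) ≈w (u' ++ v')
  ≈w-++ {u' = u'} {v = v} p q = ≈w-++ʳ v p ◅◅ ≈w-++ˡ u' q

  invW-∷ : ∀ (c : Letter n) a → invW (c ∷ a) ≡ invW a ++ [ invL c ]
  invW-∷ c a = unfold-reverse (invL c) (map invL a)

  invW-++ : ∀ (a b : Word n) → invW (a ++ b) ≡ invW b ++ invW a
  invW-++ a b = trans (cong reverse (map-++ invL a b)) (reverse-++ (map invL a) (map invL b))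

  invW-involutive : ∀ (a : Word n) → invW (invW a) ≡ a
  invW-involutive [] = refl
  invW-involutive (c ∷ a) = begin
    invW (invW (c ∷ a))             ≡⟨ cong invW (invW-∷ c a) ⟩
    invW (invW a ++ [ invL c ])     ≡⟨ invW-++ (invW a) [ invL c ] ⟩
    invL (invL c) ∷ invW (invW a)   ≡⟨ cong₂ _∷_ (invL-involutive c) (invW-involutive a) ⟩
    c ∷ a                           ∎
    where open ≡-Reasoning

  inverseˡ : ∀ (a : Word n) → (invW a ++ a) ≈w []
  inverseˡ [] = ε
  inverseˡ (c ∷ a) = begin
    invW (c ∷ a) ++ c ∷ a              ≡⟨ cong (_++ c ∷ a) (invW-∷ c a) ⟩
    (invW a ++ [ invL c ]) ++ c ∷ a    ≡⟨ ++-assoc (invW a) [ invL c ] (c ∷ a) ⟩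
    invW a ++ invL c ∷ c ∷ a           ≈⟨ EqClosure.return cancelled ⟩
    invW a ++ a                        ≈⟨ inverseˡ a ⟩
    []                                 ∎
    where
      open ≈w-Reasoning
      cancelled : Cancel (invW a ++ invL c ∷ c ∷ a) (invW a ++ a)
      cancelled = subst (λ y → Cancel (invW a ++ invL c ∷ y ∷ a) (invW a ++ a))
                        (invL-involutive c) (cancel (invW a) a (invL c))

  inverseʳ : ∀ (a : Word n) → (a ++ invW a) ≈w []
  inverseʳ a = subst (λ b → (b ++ invW a) ≈w []) (invW-involutive a) (inverseˡ (invW a))

  cancelˡ : ∀ (u w : Word n) → (invW u ++ u ++ w) ≈w w
  cancelˡ u w = begin
    invW u ++ u ++ w     ≡⟨ ++-assoc (invW u) u w ⟨
    (invW u ++ u) ++ w   ≈⟨ ≈w-++ʳ w (inverseˡ u) ⟩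
    w                    ∎
    where open ≈w-Reasoning

  cancelʳ : ∀ (u w : Word n) → (u ++ invW u ++ w) ≈w w
  cancelʳ u w = begin
    u ++ invW u ++ w     ≡⟨ ++-assoc u (invW u) w ⟨
    (u ++ invW u) ++ w   ≈⟨ ≈w-++ʳ w (inverseʳ u) ⟩
    w                    ∎
    where open ≈w-Reasoning

  ≈w-invW : ∀ {a b : Word n} → a ≈w b → invW a ≈w invW b
  ≈w-invW {a} {b} a≈b = begin
    invW a                      ≡⟨ ++-identityʳ (invW a) ⟨
    invW a ++ []                ≈⟨ ≈w-++ˡ (invW a) (inverseʳ b) ⟨
    invW a ++ b ++ invW b       ≈⟨ ≈w-++ˡ (invW a) (≈w-++ʳ (invW b) a≈b) ⟨
    invW a ++ a ++ invW b       ≈⟨ cancelˡ a (invW b) ⟩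
    invW b                      ∎
    where open ≈w-Reasoning

  conj : Word n → Word n → Word n
  conj u h = u ++ h ++ invW u

  conj-assoc : ∀ (u h w : Word n) → conj u h ++ w ≡ u ++ h ++ invW u ++ w
  conj-assoc u h w = trans (++-assoc u (h ++ invW u) w) (cong (u ++_) (++-assoc h (invW u) w))

  conj-square : ∀ (u h : Word n) → (conj u h ++ conj u h) ≈w (u ++ h ++ h ++ invW u)
  conj-square u h = begin
    conj u h ++ conj u h                  ≡⟨ conj-assoc u h (conj u h) ⟩
    u ++ h ++ invW u ++ u ++ h ++ invW u  ≈⟨ ≈w-++ˡ u (≈w-++ˡ h (cancelˡ u (h ++ invW u))) ⟩
    u ++ h ++ h ++ invW u                 ∎
    where open ≈w-Reasoning

  conj-shift : ∀ (u h : Word n) → (conj u h ++ u) ≈w (u ++ h)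
  conj-shift u h = begin
    conj u h ++ u            ≡⟨ conj-assoc u h u ⟩
    u ++ h ++ invW u ++ u    ≈⟨ ≈w-++ˡ u (≈w-++ˡ h (inverseˡ u)) ⟩
    u ++ h ++ []             ≡⟨ cong (u ++_) (++-identityʳ h) ⟩
    u ++ h                   ∎
    where open ≈w-Reasoning

  detour : ∀ (a b : Word n) → ((a ++ invW b) ++ a ++ invW a ++ b) ≈w a
  detour a b = begin
    (a ++ invW b) ++ a ++ invW a ++ b   ≈⟨ ≈w-++ˡ (a ++ invW b) (cancelʳ a b) ⟩
    (a ++ invW b) ++ b                  ≡⟨ ++-assoc a (invW b) b ⟩
    a ++ invW b ++ b                    ≈⟨ ≈w-++ˡ a (inverseˡ b) ⟩
    a ++ []                             ≡⟨ ++-identityʳ a ⟩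
    a                                   ∎
    where open ≈w-Reasoning

  -- Normal forms: push x w is the reduced form of x w when w is reduced.
  push : Letter n → Word n → Word n
  push x [] = x ∷ []
  push x (y ∷ s) with y ≟L invL x
  ... | yes _ = s
  ... | no _ = x ∷ y ∷ s

  nf : Word n → Word n
  nf = foldr push []

  Reduced : Word n → Set
  Reduced [] = ⊤
  Reduced (x ∷ []) = ⊤
  Reduced (x ∷ y ∷ s) = (y ≢ invL x) × Reduced (y ∷ s)

  reduced-tail : ∀ {x s} → Reduced (x ∷ s) → Reduced s
  reduced-tail {s = []} _ = _
  reduced-tail {s = y ∷ s} (_ , r) = r

  push-reduced : ∀ x s → Reduced s → Reduced (push x s)
  push-reduced x [] _ = _
  push-reduced x (y ∷ s) r with y ≟L invL x
  ... | yes _ = reduced-tail r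
  ... | no y≢x⁻¹ = y≢x⁻¹ , r

  nf-reduced : ∀ w → Reduced (nf w)
  nf-reduced [] = _
  nf-reduced (x ∷ w) = push-reduced x (nf w) (nf-reduced w)

  reduced⇒nf-id : ∀ w → Reduced w → nf w ≡ w
  reduced⇒nf-id [] _ = refl
  reduced⇒nf-id (x ∷ []) _ = refl
  reduced⇒nf-id (x ∷ y ∷ s) (y≢x⁻¹ , r) rewrite reduced⇒nf-id (y ∷ s) r with y ≟L invL x
  ... | yes y≡x⁻¹ = ⊥-elim (y≢x⁻¹ y≡x⁻¹)
  ... | no _ = refl

  push-cancel : ∀ x m → Reduced m → push x (push (invL x) m) ≡ m
  push-cancel x [] _ with invL x ≟L invL x
  ... | yes _ = refl
  ... | no ne = ⊥-elim (ne refl)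
  push-cancel x (y ∷ s) r with y ≟L invL (invL x)
  push-cancel x (y ∷ []) r | yes y≡x = cong [_] (sym (trans y≡x (invL-involutive x)))
  push-cancel x (y ∷ y' ∷ s) (y'≢y⁻¹ , r) | yes y≡x with y' ≟L invL x
  ... | yes y'≡x⁻¹ = ⊥-elim (y'≢y⁻¹ (trans y'≡x⁻¹ (cong invL (sym (trans y≡x (invL-involutive x))))))
  ... | no _ = cong (λ z → z ∷ y' ∷ s) (sym (trans y≡x (invL-involutive x)))
  push-cancel x (y ∷ s) r | no _ with invL x ≟L invL x
  ... | yes _ = refl
  ... | no ne = ⊥-elim (ne refl)

  nf-cancel : ∀ {u v : Word n} → Cancel u v → nf u ≡ nf v
  nf-cancel (cancel u v x) = trans (foldr-++ push [] u (x ∷ invL x ∷ v))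
    (trans (cong (λ m → foldr push m u) (push-cancel x (nf v) (nf-reduced v)))
           (sym (foldr-++ push [] u v)))

  ≈w⇒nf≡ : ∀ {u v : Word n} → u ≈w v → nf u ≡ nf v
  ≈w⇒nf≡ = EqClosure.gfold isEquivalence nf nf-cancel

  push-≈w : ∀ x s → push x s ≈w (x ∷ s)
  push-≈w x [] = ε
  push-≈w x (y ∷ s) with y ≟L invL x
  ... | yes refl = ≈w-sym (EqClosure.return (cancel [] s x))
  ... | no _ = ε

  nf-≈w : ∀ w → nf w ≈w w
  nf-≈w [] = ε
  nf-≈w (x ∷ w) = push-≈w x (nf w) ◅◅ ≈w-++ˡ [ x ] (nf-≈w w)

  reduced-prefix : ∀ (a b : Word n) → Reduced (a ++ b) → Reduced a
  reduced-prefix [] b r = _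
  reduced-prefix (x ∷ []) b r = _
  reduced-prefix (x ∷ y ∷ a) b (ne , r) = ne , reduced-prefix (y ∷ a) b r

  reduced-suffix : ∀ (a b : Word n) → Reduced (a ++ b) → Reduced b
  reduced-suffix [] b r = r
  reduced-suffix (x ∷ a) b r = reduced-suffix a b (reduced-tail r)

  reduced-glue : ∀ (a b c : Word n) → Reduced (a ++ b) → Reduced (b ++ c) → b ≢ [] → Reduced (a ++ b ++ c)
  reduced-glue [] b c _ r₂ _ = r₂
  reduced-glue (y ∷ []) [] c _ _ b≢[] = ⊥-elim (b≢[] refl)
  reduced-glue (y ∷ []) (x ∷ b) c (ne , _) r₂ _ = ne , r₂
  reduced-glue (y ∷ y' ∷ a) b c (ne , r₁) r₂ b≢[] = ne , reduced-glue (y' ∷ a) b c r₁ r₂ b≢[]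

  CyclicallyReduced : Word n → Set
  CyclicallyReduced h = (h ≢ []) × Reduced (h ++ h)

  square-reduced : ∀ u h → Reduced (conj u h) → CyclicallyReduced h → Reduced (u ++ h ++ h ++ invW u)
  square-reduced u h r (h≢[] , hh) =
    reduced-glue u h (h ++ invW u) (reduced-prefix (u ++ h) (invW u) (subst Reduced (sym (++-assoc u h (invW u))) r))
      (reduced-glue h h (invW u) hh (reduced-suffix u (h ++ invW u) r) h≢[]) h≢[]

  private
    snoc-view : (xs : Word n) → (xs ≡ []) ⊎ Σ (Word n) λ ys → Σ (Letter n) λ y → xs ≡ ys ++ [ y ]
    snoc-view [] = inj₁ refl
    snoc-view (x ∷ xs) with snoc-view xs
    ... | inj₁ refl = inj₂ ([] , x , refl)
    ... | inj₂ (ys , y , refl) = inj₂ (x ∷ ys , y , refl)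

  -- Every reduced word is u h u⁻¹ with h empty or cyclically reduced: peel
  -- off matching first/last letters (induction on a length bound).
  CyclicDecomposition : Word n → Set
  CyclicDecomposition t =
    Σ (Word n) λ u → Σ (Word n) λ h → (t ≡ conj u h) × ((h ≡ []) ⊎ CyclicallyReduced h)

  cyclic-decomposition : ∀ k (t : Word n) → length t ≤ k → Reduced t → CyclicDecomposition t
  cyclic-decomposition k [] _ _ = [] , [] , refl , inj₁ refl
  cyclic-decomposition k (c ∷ rest) len r with snoc-view rest
  ... | inj₁ refl = [] , [ c ] , refl , inj₂ ((λ ()) , invL-≢ c , _)
  cyclic-decomposition (suc k) (c ∷ .(m ++ [ d ])) (s≤s len) r | inj₂ (m , d , refl) with d ≟L invL c
  ... | yes d≡c⁻¹ with cyclic-decomposition k m (≤-trans (length-++-≤ˡ m) len) (reduced-prefix m [ d ] (reduced-tail r))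
  ...   | u , h , m≡uhu⁻¹ , cyc = c ∷ u , h , cong (c ∷_) outer , cyc
    where
      outer : m ++ [ d ] ≡ u ++ h ++ invW (c ∷ u)
      outer = begin
        m ++ [ d ]                          ≡⟨ cong₂ (λ a b → a ++ [ b ]) m≡uhu⁻¹ d≡c⁻¹ ⟩
        conj u h ++ [ invL c ]              ≡⟨ conj-assoc u h [ invL c ] ⟩
        u ++ h ++ invW u ++ [ invL c ]      ≡⟨ cong (λ z → u ++ h ++ z) (invW-∷ c u) ⟨
        u ++ h ++ invW (c ∷ u)              ∎
        where open ≡-Reasoning
  cyclic-decomposition (suc k) (c ∷ .(m ++ [ d ])) (s≤s len) r | inj₂ (m , d , refl) | no d≢c⁻¹ =
      [] , t , sym (++-identityʳ t) , inj₂ ((λ ()) , t²-reduced)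
    where
      t : Word n
      t = c ∷ (m ++ [ d ])
      c≢d⁻¹ : c ≢ invL d
      c≢d⁻¹ e = d≢c⁻¹ (trans (sym (invL-involutive d)) (cong invL (sym e)))
      t²-reduced : Reduced (t ++ t)
      t²-reduced = subst Reduced (cong (c ∷_) (sym (++-assoc m [ d ] t)))
                     (reduced-glue (c ∷ m) [ d ] t r (c≢d⁻¹ , r) (λ ()))

-- A folded graph over X_n, up to an equivalence _~_ on vertices: darts are
-- oriented edges with a reversal, and two darts with the same
-- label leaving equivalent vertices end at equivalent vertices.  Both the
-- immersion X (with _~_ = _≡_) and the finite graphs produced by folding
-- (with _~_ = "same class") are instances.
record FoldedGraph (n : ℕ) : Set₁ where
  field
    Vertex Dart : Set
    src tgt     : Dart → Vertex
    lab         : Dart → Letter n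
    rev         : Dart → Dart
    _~_         : Vertex → Vertex → Set
    ~-refl      : ∀ {x} → x ~ x
    ~-sym       : ∀ {x y} → x ~ y → y ~ x
    ~-trans     : ∀ {x y z} → x ~ y → y ~ z → x ~ z
    folded      : ∀ d d' → lab d ≡ lab d' → src d ~ src d' → tgt d ~ tgt d'
    rev-src     : ∀ d → src (rev d) ~ tgt d
    rev-tgt     : ∀ d → tgt (rev d) ~ src d
    rev-lab     : ∀ d → lab (rev d) ≡ invL (lab d)

module Walks {n : ℕ} (G : FoldedGraph n) where
  open FoldedGraph G
  open FreeGroup {n}

  data Walk : Vertex → Vertex → Set where
    done : ∀ {x y} → x ~ y → Walk x y
    step : ∀ {x z} (d : Dart) → x ~ src d → Walk (tgt d) z → Walk x z

  word : ∀ {x y} → Walk x y → Word n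
  word (done _) = []
  word (step d _ p) = lab d ∷ word p

  restart : ∀ {x y z} → x ~ y → Walk y z → Walk x z
  restart r (done r') = done (~-trans r r')
  restart r (step d r' p) = step d (~-trans r r') p

  word-restart : ∀ {x y z} (r : x ~ y) (p : Walk y z) → word (restart r p) ≡ word p
  word-restart r (done _) = refl
  word-restart r (step d _ p) = refl

  infixr 5 _++ʷ_
  _++ʷ_ : ∀ {x y z} → Walk x y → Walk y z → Walk x z
  done r ++ʷ q = restart r q
  step d r p ++ʷ q = step d r (p ++ʷ q)

  word-++ʷ : ∀ {x y z} (p : Walk x y) (q : Walk y z) → word (p ++ʷ q) ≡ word p ++ word q
  word-++ʷ (done r) q = word-restart r q
  word-++ʷ (step d r p) q = cong (lab d ∷_) (word-++ʷ p q)

  reverseʷ : ∀ {x y} → Walk x y → Walk y x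
  reverseʷ (done r) = done (~-sym r)
  reverseʷ (step d r p) = reverseʷ p ++ʷ step (rev d) (~-sym (rev-src d)) (done (~-trans (rev-tgt d) (~-sym r)))

  word-reverseʷ : ∀ {x y} (p : Walk x y) → word (reverseʷ p) ≡ invW (word p)
  word-reverseʷ (done r) = refl
  word-reverseʷ (step d r p) = begin
    word (reverseʷ p ++ʷ step (rev d) _ _)   ≡⟨ word-++ʷ (reverseʷ p) _ ⟩
    word (reverseʷ p) ++ [ lab (rev d) ]      ≡⟨ cong₂ (λ a b → a ++ [ b ]) (word-reverseʷ p) (rev-lab d) ⟩
    invW (word p) ++ [ invL (lab d) ]         ≡⟨ invW-∷ (lab d) (word p) ⟨
    invW (lab d ∷ word p)                     ∎
    where open ≡-Reasoning

  split : ∀ {x z} (a b : Word n) (p : Walk x z) → word p ≡ a ++ b →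
          Σ Vertex λ m → Σ (Walk x m) λ p₁ → Σ (Walk m z) λ p₂ → (word p₁ ≡ a) × (word p₂ ≡ b)
  split {x} [] b p e = x , done ~-refl , p , refl , e
  split (c ∷ a) b (done _) ()
  split (c ∷ a) b (step d r p) e with ∷-injective e
  ... | c≡ , rest with split a b p rest
  ...   | m , p₁ , p₂ , e₁ , e₂ = m , step d r p₁ , p₂ , cong₂ _∷_ c≡ e₁ , e₂

  -- Foldedness lets a backtrack d d⁻¹ at the start of a walk be cut out.
  backtrack : ∀ d d' → lab d' ≡ invL (lab d) → tgt d ~ src d' → src d ~ tgt d'
  backtrack d d' l r =
    ~-trans (~-sym (rev-tgt d)) (folded (rev d) d' (trans (rev-lab d) (sym l)) (~-trans (rev-src d) r))

  push-step : ∀ {x z} (d : Dart) → x ~ src d → (q : Walk (tgt d) z) →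
              Σ (Walk x z) λ p → word p ≡ push (lab d) (word q)
  push-step d r (done r') = step d r (done r') , refl
  push-step d r (step d' r' q) with lab d' ≟L invL (lab d)
  ... | yes l = restart (~-trans r (backtrack d d' l r')) q , word-restart _ q
  ... | no _ = step d r (step d' r' q) , refl

  reduce : ∀ {x y} (p : Walk x y) → Σ (Walk x y) λ q → word q ≡ nf (word p)
  reduce (done r) = done r , refl
  reduce (step d r p) with reduce p
  ... | q , e with push-step d r q
  ...   | q' , e' = q' , trans e' (cong (push (lab d)) e)

  -- Determinism: walks with the same word from equivalent vertices end at
  -- equivalent vertices; by reduction, equality in F_n suffices.
  deterministic : ∀ {x x' y y'} (p : Walk x y) (q : Walk x' y') → x ~ x' → word p ≡ word q → y ~ y'
  deterministic (done r) (done r') xx' _ = ~-trans (~-sym r) (~-trans xx' r')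
  deterministic (done r) (step d r' q) xx' ()
  deterministic (step d r p) (done r') xx' ()
  deterministic (step d r p) (step d' r' q) xx' e with ∷-injective e
  ... | l , rest = deterministic p q (folded d d' l (~-trans (~-sym r) (~-trans xx' r'))) rest

  deterministic≈ : ∀ {x x' y y'} (p : Walk x y) (q : Walk x' y') → x ~ x' → word p ≈w word q → y ~ y'
  deterministic≈ p q xx' p≈q with reduce p | reduce q
  ... | p' , ep | q' , eq = deterministic p' q' xx' (trans ep (trans (≈w⇒nf≡ p≈q) (sym eq)))

module Immersion {n : ℕ} (X : LGraph n) (imm : IsImmersion X) where

  Dart : Set
  Dart = E X × Bool

  dsrc dtgt : Dart → V X
  dsrc (e , true) = ι X e
  dsrc (e , false) = τ X e
  dtgt (e , true) = τ X e
  dtgt (e , false) = ι X e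

  dlab : Dart → Letter n
  dlab (e , b) = label X e , b

  folded : ∀ d d' → dlab d ≡ dlab d' → dsrc d ≡ dsrc d' → dtgt d ≡ dtgt d'
  folded (e , true) (e' , true) l s with proj₁ imm e e' s (cong proj₁ l)
  ... | refl = refl
  folded (e , false) (e' , false) l s with proj₂ imm e e' s (cong proj₁ l)
  ... | refl = refl
  folded (e , true) (e' , false) () s
  folded (e , false) (e' , true) () s

  flip : Dart → Dart
  flip (e , b) = e , not b

  flip-src : ∀ d → dsrc (flip d) ≡ dtgt d
  flip-src (e , true) = refl
  flip-src (e , false) = refl

  flip-tgt : ∀ d → dtgt (flip d) ≡ dsrc d
  flip-tgt (e , true) = refl
  flip-tgt (e , false) = refl

  graph : FoldedGraph n
  graph = record
    { Vertex = V X ; Dart = Dart ; src = dsrc ; tgt = dtgt ; lab = dlab ; rev = flip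
    ; _~_ = _≡_ ; ~-refl = refl ; ~-sym = sym ; ~-trans = trans
    ; folded = folded ; rev-src = flip-src ; rev-tgt = flip-tgt ; rev-lab = λ _ → refl
    }

  open Walks graph public

  toWalk : ∀ {x y} → Path X x y → Walk x y
  toWalk nil = done refl
  toWalk (fwd e p) = step (e , true) refl (toWalk p)
  toWalk (bwd e p) = step (e , false) refl (toWalk p)

  word-toWalk : ∀ {x y} (p : Path X x y) → word (toWalk p) ≡ pathLabel p
  word-toWalk nil = refl
  word-toWalk (fwd e p) = cong (_ ∷_) (word-toWalk p)
  word-toWalk (bwd e p) = cong (_ ∷_) (word-toWalk p)

  toPath : ∀ {x y} → Walk x y → Path X x y
  toPath (done refl) = nil
  toPath (step (e , true) refl p) = fwd e (toPath p)
  toPath (step (e , false) refl p) = bwd e (toPath p)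

  pathLabel-toPath : ∀ {x y} (p : Walk x y) → pathLabel (toPath p) ≡ word p
  pathLabel-toPath (done refl) = refl
  pathLabel-toPath (step (e , true) refl p) = cong (_ ∷_) (pathLabel-toPath p)
  pathLabel-toPath (step (e , false) refl p) = cong (_ ∷_) (pathLabel-toPath p)

  unzip : ∀ {a b} → Path (X ⊗ X) a b →
          Σ (Walk (proj₁ a) (proj₁ b)) λ p → Σ (Walk (proj₂ a) (proj₂ b)) λ q → word p ≡ word q
  unzip nil = done refl , done refl , refl
  unzip (fwd ((e₁ , e₂) , l) P) with unzip P
  ... | p , q , e = step (e₁ , true) refl p , step (e₂ , true) refl q , cong₂ _∷_ (cong (_, true) l) e
  unzip (bwd ((e₁ , e₂) , l) P) with unzip P
  ... | p , q , e = step (e₁ , false) refl p , step (e₂ , false) refl q , cong₂ _∷_ (cong (_, false) l) e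

  zip : ∀ {x₁ x₂ y₁ y₂} (p : Walk x₁ y₁) (q : Walk x₂ y₂) → word p ≡ word q → Path (X ⊗ X) (x₁ , x₂) (y₁ , y₂)
  zip (done refl) (done refl) _ = nil
  zip (done _) (step _ _ _) ()
  zip (step _ _ _) (done _) ()
  zip (step (e₁ , b₁) refl p) (step (e₂ , b₂) refl q) e with ∷-injective e
  zip (step (e₁ , true) refl p) (step (e₂ , true) refl q) e | l , rest = fwd ((e₁ , e₂) , cong proj₁ l) (zip p q rest)
  zip (step (e₁ , false) refl p) (step (e₂ , false) refl q) e | l , rest = bwd ((e₁ , e₂) , cong proj₁ l) (zip p q rest)
  zip (step (e₁ , true) refl p) (step (e₂ , false) refl q) e | () , _
  zip (step (e₁ , false) refl p) (step (e₂ , true) refl q) e | () , _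

  module Represents (H : Word n → Set) (x₀ : V X) (img : ∀ w → InImage X x₀ w ⇔ H w) where

    loop-for : ∀ {w} → H w → Σ (Walk x₀ x₀) λ ℓ → word ℓ ≈w w
    loop-for {w} w∈H with from (img w) w∈H
    ... | P , P≈w = toWalk P , subst (_≈w w) (sym (word-toWalk P)) P≈w

    loop-word∈H : ∀ {w} (ℓ : Walk x₀ x₀) → word ℓ ≈w w → H w
    loop-word∈H {w} ℓ ℓ≈w = to (img w) (toPath ℓ , subst (_≈w w) (sym (pathLabel-toPath ℓ)) ℓ≈w)

module Forward {n : ℕ} (H : Word n → Set) (X : LGraph n) (imm : IsImmersion X) (conn : Connected X)
               (x₀ : V X) (img : ∀ w → InImage X x₀ w ⇔ H w) where
  open FreeGroup {n}
  open Immersion X imm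
  open Represents H x₀ img

  no-swap : SqrtClosed H → ∀ (x₁ x₂ : V X) → x₁ ≢ x₂ → ¬ Path (X ⊗ X) (x₁ , x₂) (x₂ , x₁)
  no-swap sqrt-closed x₁ x₂ x₁≢x₂ P with unzip P
  ... | A , B , wA≡wB = x₁≢x₂ (deterministic≈ (proj₁ ℓ ++ʷ c) (c ++ʷ A) refl same-word)
    where
      c : Walk x₀ x₁
      c = toWalk (conn x₀ x₁)

      g : Word n
      g = conj (word c) (word A)

      square : Walk x₀ x₀
      square = c ++ʷ A ++ʷ B ++ʷ reverseʷ c

      square≈g² : word square ≈w (g ++ g)
      square≈g² = begin
        word square                                            ≡⟨ word-++ʷ c _ ⟩
        word c ++ word (A ++ʷ B ++ʷ reverseʷ c)                 ≡⟨ cong (word c ++_) (word-++ʷ A _) ⟩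
        word c ++ word A ++ word (B ++ʷ reverseʷ c)             ≡⟨ cong (λ z → word c ++ word A ++ z) (word-++ʷ B _) ⟩
        word c ++ word A ++ word B ++ word (reverseʷ c)         ≡⟨ cong₂ (λ b r → word c ++ word A ++ b ++ r) (sym wA≡wB) (word-reverseʷ c) ⟩
        word c ++ word A ++ word A ++ invW (word c)             ≈⟨ conj-square (word c) (word A) ⟨
        g ++ g                                                 ∎
        where open ≈w-Reasoning

      ℓ : Σ (Walk x₀ x₀) λ ℓ → word ℓ ≈w g
      ℓ = loop-for (sqrt-closed g (loop-word∈H square square≈g²))

      same-word : word (proj₁ ℓ ++ʷ c) ≈w word (c ++ʷ A)
      same-word = begin
        word (proj₁ ℓ ++ʷ c)          ≡⟨ word-++ʷ (proj₁ ℓ) c ⟩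
        word (proj₁ ℓ) ++ word c      ≈⟨ ≈w-++ʳ (word c) (proj₂ ℓ) ⟩
        g ++ word c                   ≈⟨ conj-shift (word c) (word A) ⟩
        word c ++ word A              ≡⟨ word-++ʷ c A ⟨
        word (c ++ʷ A)                ∎
        where open ≈w-Reasoning

-- Counting the fixed points of c below N; used as termination measure for
-- folding, which only ever removes fixed points (class representatives).
fixedCount : (ℕ → ℕ) → ℕ → ℕ
fixedCount c zero = zero
fixedCount c (suc k) with c k ≟ k
... | yes _ = suc (fixedCount c k)
... | no _ = fixedCount c k

fixedCount-≤ : ∀ c k → fixedCount c k ≤ k
fixedCount-≤ c zero = z≤n
fixedCount-≤ c (suc k) with c k ≟ k
... | yes _ = s≤s (fixedCount-≤ c k)
... | no _ = m≤n⇒m≤1+n (fixedCount-≤ c k)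

fixedCount-mono : ∀ c c' → (∀ i → c' i ≡ i → c i ≡ i) → ∀ k → fixedCount c' k ≤ fixedCount c k
fixedCount-mono c c' keep zero = z≤n
fixedCount-mono c c' keep (suc k) with c k ≟ k | c' k ≟ k
... | yes _ | yes _ = s≤s (fixedCount-mono c c' keep k)
... | yes _ | no _ = m≤n⇒m≤1+n (fixedCount-mono c c' keep k)
... | no ck | yes c'k = ⊥-elim (ck (keep k c'k))
... | no _ | no _ = fixedCount-mono c c' keep k

fixedCount-< : ∀ c c' → (∀ i → c' i ≡ i → c i ≡ i) → ∀ j → c j ≡ j → c' j ≢ j →
               ∀ k → j < k → fixedCount c' k < fixedCount c k
fixedCount-< c c' keep j cj c'j (suc k) j<1+k with c k ≟ k | c' k ≟ k
... | yes _ | yes c'k = s≤s (fixedCount-< c c' keep j cj c'j k (≤∧≢⇒< (s≤s⁻¹ j<1+k) λ { refl → c'j c'k }))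
... | yes _ | no _ = s≤s (fixedCount-mono c c' keep k)
... | no ck | yes c'k = ⊥-elim (ck (keep k c'k))
... | no ck | no _ = fixedCount-< c c' keep j cj c'j k (≤∧≢⇒< (s≤s⁻¹ j<1+k) λ { refl → ck cj })

-- A dart of a walk recorded on positions ℕ: (source, label, target).
Triple : ℕ → Set
Triple n = ℕ × Letter n × ℕ

-- Stallings folding of a finite graph on positions ℕ.  The positions are
-- mapped by φ to a set V carrying a deterministic labelled step relation;
-- the darts D are realised by steps between their images, and the pairs Ps
-- have equal images.  Folding computes an equivalence on positions (given by
-- class representatives, hence decidable) that identifies the pairs Ps,
-- is closed under folding D, and only identifies positions with equal images.
module Folding {n : ℕ} {V : Set} (Step : V → Letter n → V → Set)
  (step-det : ∀ {a x b b'} → Step a x b → Step a x b' → b ≡ b')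
  (φ : ℕ → V) (D : List (Triple n)) (N : ℕ)
  (D-bounded : ∀ {a x b} → (a , x , b) ∈ D → b < N)
  (D-realised : ∀ {a x b} → (a , x , b) ∈ D → Step (φ a) x (φ b))
  (Ps : List (ℕ × ℕ)) (Ps-realised : ∀ {i j} → (i , j) ∈ Ps → φ i ≡ φ j) where

  open FreeGroup {n} using (_≟L_)

  record Partition : Set where
    field
      rep       : ℕ → ℕ
      rep-≤     : ∀ i → rep i ≤ i
      rep-idem  : ∀ i → rep (rep i) ≡ rep i
      rep-image : ∀ i → φ (rep i) ≡ φ i
  open Partition

  same-class⇒same-image : ∀ s {i j} → rep s i ≡ rep s j → φ i ≡ φ j
  same-class⇒same-image s {i} {j} e = trans (sym (rep-image s i)) (trans (cong φ e) (rep-image s j))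

  Coarser : Partition → Partition → Set
  Coarser s s' = ∀ i j → rep s i ≡ rep s j → rep s' i ≡ rep s' j

  module Join (s : Partition) (lo hi : ℕ) (lo<hi : lo < hi)
              (lo-rep : rep s lo ≡ lo) (hi-rep : rep s hi ≡ hi) (φlo≡φhi : φ lo ≡ φ hi) where

    rep' : ℕ → ℕ
    rep' i with rep s i ≟ hi
    ... | yes _ = lo
    ... | no _ = rep s i

    joined : Partition
    joined = record { rep = rep' ; rep-≤ = ≤' ; rep-idem = idem' ; rep-image = image' }
      where
        ≤' : ∀ i → rep' i ≤ i
        ≤' i with rep s i ≟ hi
        ... | yes e = ≤-trans (<⇒≤ lo<hi) (subst (_≤ i) e (rep-≤ s i))
        ... | no _ = rep-≤ s i
        idem' : ∀ i → rep' (rep' i) ≡ rep' i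
        idem' i with rep s i ≟ hi
        idem' i | yes _ with rep s lo ≟ hi
        ... | yes e = ⊥-elim (<-irrefl (trans (sym lo-rep) e) lo<hi)
        ... | no _ = lo-rep
        idem' i | no ne with rep s (rep s i) ≟ hi
        ... | yes e = ⊥-elim (ne (trans (sym (rep-idem s i)) e))
        ... | no _ = rep-idem s i
        image' : ∀ i → φ (rep' i) ≡ φ i
        image' i with rep s i ≟ hi
        ... | yes e = trans φlo≡φhi (trans (cong φ (sym e)) (rep-image s i))
        ... | no _ = rep-image s i

    coarsens : Coarser s joined
    coarsens i j e with rep s i ≟ hi | rep s j ≟ hi
    ... | yes _ | yes _ = refl
    ... | yes p | no q = ⊥-elim (q (trans (sym e) p))
    ... | no p | yes q = ⊥-elim (p (trans e q))
    ... | no _ | no _ = e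

    hi-joined : rep' hi ≡ rep' lo
    hi-joined with rep s hi ≟ hi | rep s lo ≟ hi
    ... | yes _ | yes _ = refl
    ... | yes _ | no _ = sym lo-rep
    ... | no ne | _ = ⊥-elim (ne hi-rep)

    keeps-fixed : ∀ i → rep' i ≡ i → rep s i ≡ i
    keeps-fixed i e with rep s i ≟ hi
    ... | yes e' = ⊥-elim (<-irrefl (trans (sym lo-rep) (trans (cong (rep s) e) e')) lo<hi)
    ... | no _ = e

    loses-hi : rep' hi ≢ hi
    loses-hi e with rep s hi ≟ hi
    ... | yes _ = <-irrefl e lo<hi
    ... | no ne = ne hi-rep

  record Merge (s : Partition) (a b : ℕ) : Set where
    field
      merged  : Partition
      coarser : Coarser s merged
      joins   : rep merged a ≡ rep merged b
      shrinks : a < N → b < N → fixedCount (rep merged) N < fixedCount (rep s) N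
  open Merge

  merge-below : ∀ s a b → rep s a < rep s b → φ a ≡ φ b → Merge s a b
  merge-below s a b lt φa≡φb = record
    { merged  = joined
    ; coarser = coarsens
    ; joins   = trans (coarsens a (rep s a) (sym (rep-idem s a)))
                  (trans (sym hi-joined) (sym (coarsens b (rep s b) (sym (rep-idem s b)))))
    ; shrinks = λ _ b<N → fixedCount-< (rep s) rep' keeps-fixed (rep s b) (rep-idem s b) loses-hi N
                            (≤-<-trans (rep-≤ s b) b<N)
    }
    where
      open Join s (rep s a) (rep s b) lt (rep-idem s a) (rep-idem s b)
                (trans (rep-image s a) (trans φa≡φb (sym (rep-image s b))))

  merge-flip : ∀ {s a b} → Merge s b a → Merge s a b
  merge-flip m = record { merged = merged m ; coarser = coarser m ; joins = sym (joins m)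
                        ; shrinks = λ a<N b<N → shrinks m b<N a<N }

  merge : ∀ s a b → φ a ≡ φ b → (rep s a ≡ rep s b) ⊎ Merge s a b
  merge s a b φa≡φb with <-cmp (rep s a) (rep s b)
  ... | tri< lt _ _ = inj₂ (merge-below s a b lt φa≡φb)
  ... | tri≈ _ e _ = inj₁ e
  ... | tri> _ _ gt = inj₂ (merge-flip (merge-below s b a gt (sym φa≡φb)))

  merge-pairs : ∀ s (qs : List (ℕ × ℕ)) → (∀ {i j} → (i , j) ∈ qs → φ i ≡ φ j) →
                Σ Partition λ s' → Coarser s s' × (∀ {i j} → (i , j) ∈ qs → rep s' i ≡ rep s' j)
  merge-pairs s [] _ = s , (λ _ _ e → e) , λ ()
  merge-pairs s ((i , j) ∷ qs) qs-realised with merge s i j (qs-realised (here refl))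
  ... | inj₁ e with merge-pairs s qs (qs-realised ∘ there)
  ...   | s' , c' , joined = s' , c' , λ { (here refl) → c' i j e ; (there m) → joined m }
  merge-pairs s ((i , j) ∷ qs) qs-realised | inj₂ m with merge-pairs (merged m) qs (qs-realised ∘ there)
  ...   | s' , c' , joined = s' , (λ a b e → c' a b (coarser m a b e)) ,
                             λ { (here refl) → c' i j (joins m) ; (there m') → joined m' }

  Closed : Partition → Set
  Closed s = ∀ {a x b a' b'} → (a , x , b) ∈ D → (a' , x , b') ∈ D → rep s a ≡ rep s a' → rep s b ≡ rep s b'

  Conflict : Partition → Triple n → Triple n → Set
  Conflict s (a , x , b) (a' , x' , b') = (x ≡ x') × (rep s a ≡ rep s a') × (rep s b ≢ rep s b')

  find-conflict : ∀ s → (Σ (Triple n) λ t → Σ (Triple n) λ t' → t ∈ D × t' ∈ D × Conflict s t t') ⊎ Closed s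
  find-conflict s with any? (λ t → any? (λ t' → conflict? t t') D) D
    where
      conflict? : ∀ t t' → Dec (Conflict s t t')
      conflict? (a , x , b) (a' , x' , b') = (x ≟L x') ×-dec ((rep s a ≟ rep s a') ×-dec ¬? (rep s b ≟ rep s b'))
  ... | yes some with find some
  ...   | t , t∈D , some' with find some'
  ...     | t' , t'∈D , conflict = inj₁ (t , t' , t∈D , t'∈D , conflict)
  find-conflict s | no none = inj₂ closed
    where
      closed : Closed s
      closed {b = b} {b' = b'} t∈D t'∈D e with rep s b ≟ rep s b'
      ... | yes e' = e'
      ... | no ne = ⊥-elim (none (lose t∈D (lose t'∈D (refl , e , ne))))

  -- Repeatedly resolve a conflict by merging the two targets; each merge
  -- removes a representative below N.
  fold : ∀ fuel s → fixedCount (rep s) N < fuel → Σ Partition λ s' → Coarser s s' × Closed s'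
  fold (suc fuel) s (s≤s bound) with find-conflict s
  ... | inj₂ closed = s , (λ _ _ e → e) , closed
  ... | inj₁ ((a , x , b) , (a' , .x , b') , t∈D , t'∈D , refl , same-source , different-target)
        with merge s b b' (step-det (D-realised t∈D) (subst (λ v → Step v x (φ b')) (sym φa≡φa') (D-realised t'∈D)))
    where
      φa≡φa' : φ a ≡ φ a'
      φa≡φa' = same-class⇒same-image s same-source
  ...   | inj₁ same-target = ⊥-elim (different-target same-target)
  ...   | inj₂ m with fold fuel (merged m) (<-≤-trans (shrinks m (D-bounded t∈D) (D-bounded t'∈D)) bound)
  ...     | s' , c' , closed = s' , (λ i j e → c' i j (coarser m i j e)) , closed

  record Result : Set where
    field
      cls     : ℕ → ℕ
      sound   : ∀ {i j} → cls i ≡ cls j → φ i ≡ φ j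
      closed  : ∀ {a x b a' b'} → (a , x , b) ∈ D → (a' , x , b') ∈ D → cls a ≡ cls a' → cls b ≡ cls b'
      initial : ∀ {i j} → (i , j) ∈ Ps → cls i ≡ cls j

  discrete : Partition
  discrete = record { rep = λ i → i ; rep-≤ = λ _ → ≤-refl ; rep-idem = λ _ → refl ; rep-image = λ _ → refl }

  opaque
    result : Result
    result with merge-pairs discrete Ps Ps-realised
    ... | s₁ , _ , pairs-joined with fold (suc N) s₁ (s≤s (fixedCount-≤ (rep s₁) N))
    ...   | s₂ , c₂ , closed = record
      { cls     = rep s₂
      ; sound   = same-class⇒same-image s₂
      ; closed  = closed
      ; initial = λ m → c₂ _ _ (pairs-joined m) }

-- A walk of X recorded on consecutive positions o, o+1, … : its darts become
-- triples of positions, and a map φ : ℕ → V X "traces" the walk when it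
-- sends each position to the vertex visited there.
module Positions {n : ℕ} (X : LGraph n) (imm : IsImmersion X) where
  open FreeGroup {n}
  open Immersion X imm

  Step : V X → Letter n → V X → Set
  Step a x b = Σ Dart λ d → (dsrc d ≡ a) × (dtgt d ≡ b) × (dlab d ≡ x)

  step-det : ∀ {a x b b'} → Step a x b → Step a x b' → b ≡ b'
  step-det (d , s , t , l) (d' , s' , t' , l') = trans (sym t) (trans (folded d d' (trans l (sym l')) (trans s (sym s'))) t')

  after : ∀ {x y} → Walk x y → ℕ → ℕ
  after (done _) o = o
  after (step d r p) o = after p (suc o)

  darts : ∀ {x y} → Walk x y → ℕ → List (Triple n)
  darts (done _) o = []
  darts (step d r p) o = (o , dlab d , suc o) ∷ (suc o , invL (dlab d) , o) ∷ darts p (suc o)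

  vertexAt : ∀ {x y} → Walk x y → ℕ → V X
  vertexAt (done {x} _) i = x
  vertexAt (step {x} d r p) zero = x
  vertexAt (step d r p) (suc i) = vertexAt p i

  Traces : (ℕ → V X) → ∀ {x y} → Walk x y → ℕ → Set
  Traces φ (done {x} _) o = φ o ≡ x
  Traces φ (step {x} d r p) o = (φ o ≡ x) × Traces φ p (suc o)

  traces-start : ∀ φ {x y} (p : Walk x y) o → Traces φ p o → φ o ≡ x
  traces-start φ (done _) o t = t
  traces-start φ (step d r p) o (t , _) = t

  traces-end : ∀ φ {x y} (p : Walk x y) o → Traces φ p o → φ (after p o) ≡ y
  traces-end φ (done refl) o t = t
  traces-end φ (step d r p) o (_ , t) = traces-end φ p (suc o) t

  traces-from-vertexAt : ∀ φ {x y} (p : Walk x y) o → (∀ i → φ (i + o) ≡ vertexAt p i) → Traces φ p o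
  traces-from-vertexAt φ (done _) o h = h 0
  traces-from-vertexAt φ (step d r p) o h = h 0 , traces-from-vertexAt φ p (suc o) (λ i → trans (cong φ (+-suc i o)) (h (suc i)))

  traces-vertexAt : ∀ {x y} (p : Walk x y) → Traces (vertexAt p) p 0
  traces-vertexAt p = traces-from-vertexAt (vertexAt p) p 0 (λ i → cong (vertexAt p) (+-identityʳ i))

  after-++ʷ : ∀ {x y z} (p : Walk x y) (q : Walk y z) o → after (p ++ʷ q) o ≡ after q (after p o)
  after-++ʷ (done refl) (done _) o = refl
  after-++ʷ (done refl) (step _ _ _) o = refl
  after-++ʷ (step d r p) q o = after-++ʷ p q (suc o)

  darts-++ʷ : ∀ {x y z} (p : Walk x y) (q : Walk y z) o → darts (p ++ʷ q) o ≡ darts p o ++ darts q (after p o)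
  darts-++ʷ (done refl) (done _) o = refl
  darts-++ʷ (done refl) (step _ _ _) o = refl
  darts-++ʷ (step d r p) q o = cong (λ ts → _ ∷ _ ∷ ts) (darts-++ʷ p q (suc o))

  darts-++ʷˡ : ∀ {x y z} (p : Walk x y) (q : Walk y z) o {t} → t ∈ darts p o → t ∈ darts (p ++ʷ q) o
  darts-++ʷˡ p q o m = subst (_ ∈_) (sym (darts-++ʷ p q o)) (∈-++⁺ˡ m)

  darts-++ʷʳ : ∀ {x y z} (p : Walk x y) (q : Walk y z) o {t} → t ∈ darts q (after p o) → t ∈ darts (p ++ʷ q) o
  darts-++ʷʳ p q o m = subst (_ ∈_) (sym (darts-++ʷ p q o)) (∈-++⁺ʳ (darts p o) m)

  traces-++ʷˡ : ∀ φ {x y z} (p : Walk x y) (q : Walk y z) o → Traces φ (p ++ʷ q) o → Traces φ p o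
  traces-++ʷˡ φ (done refl) (done _) o t = t
  traces-++ʷˡ φ (done refl) (step _ refl _) o (t , _) = t
  traces-++ʷˡ φ (step d r p) q o (t₀ , t) = t₀ , traces-++ʷˡ φ p q (suc o) t

  traces-++ʷʳ : ∀ φ {x y z} (p : Walk x y) (q : Walk y z) o → Traces φ (p ++ʷ q) o → Traces φ q (after p o)
  traces-++ʷʳ φ (done refl) (done refl) o t = t
  traces-++ʷʳ φ (done refl) (step _ refl _) o t = t
  traces-++ʷʳ φ (step d r p) q o (_ , t) = traces-++ʷʳ φ p q (suc o) t

  after-≥ : ∀ {x y} (p : Walk x y) o → o ≤ after p o
  after-≥ (done _) o = ≤-refl
  after-≥ (step d r p) o = ≤-trans (n≤1+n o) (after-≥ p (suc o))

  darts-bounded : ∀ {x y} (p : Walk x y) o {a l b} → (a , l , b) ∈ darts p o → b ≤ after p o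
  darts-bounded (step d r p) o (here refl) = after-≥ p (suc o)
  darts-bounded (step d r p) o (there (here refl)) = ≤-trans (n≤1+n o) (after-≥ p (suc o))
  darts-bounded (step d r p) o (there (there m)) = darts-bounded p (suc o) m

  darts-reversible : ∀ {x y} (p : Walk x y) o {a l b} → (a , l , b) ∈ darts p o → (b , invL l , a) ∈ darts p o
  darts-reversible (step d r p) o (here refl) = there (here refl)
  darts-reversible (step d r p) o (there (here refl)) = here (cong (λ l → o , l , suc o) (invL-involutive (dlab d)))
  darts-reversible (step d r p) o (there (there m)) = there (there (darts-reversible p (suc o) m))

  darts-realised : ∀ φ {x y} (p : Walk x y) o → Traces φ p o →
                   ∀ {a l b} → (a , l , b) ∈ darts p o → Step (φ a) l (φ b)
  darts-realised φ (step d refl p) o (t₀ , t) (here refl) =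
    d , sym t₀ , sym (traces-start φ p (suc o) t) , refl
  darts-realised φ (step d refl p) o (t₀ , t) (there (here refl)) =
    flip d , trans (flip-src d) (sym (traces-start φ p (suc o) t)) , trans (flip-tgt d) (sym t₀) , refl
  darts-realised φ (step d refl p) o (_ , t) (there (there m)) = darts-realised φ p (suc o) t m

  module Folded (D : List (Triple n)) (cls : ℕ → ℕ)
    (closed : ∀ {a x b a' b'} → (a , x , b) ∈ D → (a' , x , b') ∈ D → cls a ≡ cls a' → cls b ≡ cls b')
    (reversible : ∀ {a l b} → (a , l , b) ∈ D → (b , invL l , a) ∈ D) where

    position-graph : FoldedGraph n
    position-graph = record
      { Vertex = ℕ ; Dart = Σ (Triple n) (_∈ D)
      ; src = λ { ((a , _ , _) , _) → a } ; tgt = λ { ((_ , _ , b) , _) → b } ; lab = λ { ((_ , l , _) , _) → l }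
      ; rev = λ { ((a , l , b) , m) → (b , invL l , a) , reversible m }
      ; _~_ = λ i j → cls i ≡ cls j ; ~-refl = refl ; ~-sym = sym ; ~-trans = trans
      ; folded = λ { ((a , l , b) , m) ((a' , l' , b') , m') refl r → closed m m' r }
      ; rev-src = λ _ → refl ; rev-tgt = λ _ → refl ; rev-lab = λ _ → refl
      }

    module F = Walks position-graph

    segment : ∀ {x y} (q : Walk x y) o → (∀ {t} → t ∈ darts q o → t ∈ D) →
              Σ (F.Walk o (after q o)) λ γ → F.word γ ≡ word q
    segment (done _) o _ = F.done refl , refl
    segment (step d r q) o ⊆D with segment q (suc o) (⊆D ∘ there ∘ there)
    ... | γ , e = F.step ((o , dlab d , suc o) , ⊆D (here refl)) refl γ , cong (dlab d ∷_) e

-- Finite generation makes equality of vertices reachable from x₀ decidable: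
-- fold the walk made of loops for the generators followed by a given walk
-- from x₀; the resulting classes of positions are exactly the vertices of X.
module Decide {n : ℕ} (H : Word n → Set) (X : LGraph n) (imm : IsImmersion X)
              (x₀ : V X) (img : ∀ w → InImage X x₀ w ⇔ H w)
              (gs : List (Word n)) (generated : ∀ w → H w ⇔ Generated gs w) where
  open FreeGroup {n}
  open Immersion X imm
  open Represents H x₀ img
  open Positions X imm

  LoopFor : Word n → Set
  LoopFor g = Σ (Walk x₀ x₀) λ ℓ → word ℓ ≈w g

  opaque
    generator-loops : All LoopFor gs
    generator-loops = tabulate λ {g} g∈gs →
      loop-for (from (generated g) (gen-≈ (≈w-reflexive (++-identityʳ g)) (gen-mul g∈gs gen-ε)))

  concat : ∀ {hs} → All LoopFor hs → Walk x₀ x₀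
  concat [] = done refl
  concat ((ℓ , _) ∷ ls) = ℓ ++ʷ concat ls

  -- the positions where the loops of concat ls (started at o) begin or end,
  -- each paired with position 0: all of them sit at x₀
  basepoints : ∀ {hs} → All LoopFor hs → ℕ → List (ℕ × ℕ)
  basepoints [] o = (0 , o) ∷ []
  basepoints ((ℓ , _) ∷ ls) o = (0 , o) ∷ basepoints ls (after ℓ o)

  basepoints-first : ∀ {hs} (ls : All LoopFor hs) o → (0 , o) ∈ basepoints ls o
  basepoints-first [] o = here refl
  basepoints-first (_ ∷ ls) o = here refl

  basepoints-last : ∀ {hs} (ls : All LoopFor hs) o → (0 , after (concat ls) o) ∈ basepoints ls o
  basepoints-last [] o = here refl
  basepoints-last ((ℓ , _) ∷ ls) o =
    there (subst (λ k → (0 , k) ∈ basepoints ls (after ℓ o)) (sym (after-++ʷ ℓ (concat ls) o))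
                 (basepoints-last ls (after ℓ o)))

  basepoints-at-x₀ : ∀ φ {hs} (ls : All LoopFor hs) o → Traces φ (concat ls) o →
                     ∀ {i j} → (i , j) ∈ basepoints ls o → (i ≡ 0) × (φ j ≡ x₀)
  basepoints-at-x₀ φ [] o t (here refl) = refl , t
  basepoints-at-x₀ φ ((ℓ , _) ∷ ls) o t (here refl) = refl , traces-start φ ℓ o (traces-++ʷˡ φ ℓ (concat ls) o t)
  basepoints-at-x₀ φ ((ℓ , _) ∷ ls) o t (there m) =
    basepoints-at-x₀ φ ls (after ℓ o) (traces-++ʷʳ φ ℓ (concat ls) o t) m

  module FoldStem {y : V X} (T : Walk x₀ y) where
    loops : Walk x₀ x₀
    loops = concat generator-loops

    W : Walk x₀ y
    W = loops ++ʷ T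

    φ : ℕ → V X
    φ = vertexAt W

    oT : ℕ
    oT = after loops 0

    D : List (Triple n)
    D = darts W 0

    Ps : List (ℕ × ℕ)
    Ps = basepoints generator-loops 0

    traces-W : Traces φ W 0
    traces-W = traces-vertexAt W

    traces-loops : Traces φ loops 0
    traces-loops = traces-++ʷˡ φ loops T 0 traces-W

    traces-T : Traces φ T oT
    traces-T = traces-++ʷʳ φ loops T 0 traces-W

    Ps-realised : ∀ {i j} → (i , j) ∈ Ps → φ i ≡ φ j
    Ps-realised m with basepoints-at-x₀ φ generator-loops 0 traces-loops m
    ... | refl , φj≡x₀ = trans (traces-start φ W 0 traces-W) (sym φj≡x₀)

    open Folding Step step-det φ D (suc (after W 0)) (s≤s ∘ darts-bounded W 0) (darts-realised φ W 0 traces-W) Ps Ps-realised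
    open Result result public
    open Folded D cls closed (darts-reversible W 0) public

    -- T starts in the class of position 0, where all generator loops are based
    oT~0 : cls oT ≡ cls 0
    oT~0 = sym (initial (basepoints-last generator-loops 0))

    generator-walk : ∀ {hs} (ls : All LoopFor hs) o → (∀ {t} → t ∈ darts (concat ls) o → t ∈ D) → ∀ {g} → g ∈ hs →
                     Σ ℕ λ i → Σ ℕ λ j → ((0 , i) ∈ basepoints ls o) × ((0 , j) ∈ basepoints ls o) ×
                     Σ (F.Walk i j) λ γ → F.word γ ≈w g
    generator-walk ((ℓ , ℓ≈g) ∷ ls) o ⊆D (here refl) with segment ℓ o (⊆D ∘ darts-++ʷˡ ℓ (concat ls) o)
    ... | γ , e = o , after ℓ o , here refl , there (basepoints-first ls (after ℓ o)) , γ , subst (_≈w _) (sym e) ℓ≈g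
    generator-walk ((ℓ , _) ∷ ls) o ⊆D (there g∈hs)
      with generator-walk ls (after ℓ o) (⊆D ∘ darts-++ʷʳ ℓ (concat ls) o) g∈hs
    ... | i , j , mi , mj , γ = i , j , there mi , there mj , γ

    generator-loop : ∀ {g} → g ∈ gs → Σ (F.Walk oT oT) λ γ → F.word γ ≈w g
    generator-loop g∈gs with generator-walk generator-loops 0 (darts-++ʷˡ loops T 0) g∈gs
    ... | i , j , mi , mj , γ , γ≈g =
      F.restart (trans oT~0 (initial mi)) γ F.++ʷ F.done (trans (sym (initial mj)) (sym oT~0)) ,
      subst (_≈w _) (sym (trans (F.word-++ʷ (F.restart _ γ) _) (trans (++-identityʳ _) (F.word-restart _ γ)))) γ≈g

    H-loop : ∀ {w} → Generated gs w → Σ (F.Walk oT oT) λ γ → F.word γ ≈w w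
    H-loop gen-ε = F.done refl , ε
    H-loop (gen-mul {g} {w} g∈gs w∈) with generator-loop g∈gs | H-loop w∈
    ... | γ , γ≈g | ρ , ρ≈w = γ F.++ʷ ρ , subst (_≈w (g ++ w)) (sym (F.word-++ʷ γ ρ)) (≈w-++ γ≈g ρ≈w)
    H-loop (gen-inv {g} {w} g∈gs w∈) with generator-loop g∈gs | H-loop w∈
    ... | γ , γ≈g | ρ , ρ≈w = F.reverseʷ γ F.++ʷ ρ ,
      subst (_≈w (invW g ++ w)) (sym (trans (F.word-++ʷ (F.reverseʷ γ) ρ) (cong (_++ F.word ρ) (F.word-reverseʷ γ))))
            (≈w-++ (≈w-invW γ≈g) ρ≈w)
    H-loop (gen-≈ u≈v u∈) with H-loop u∈
    ... | ρ , ρ≈u = ρ , ρ≈u ◅◅ u≈v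

    stem : Σ (F.Walk oT (after T oT)) λ γ → F.word γ ≡ word T
    stem = segment T oT (darts-++ʷʳ loops T 0)

  -- To compare the ends of p and q, fold along p p⁻¹ q: the end of p and the
  -- end of q become positions whose classes agree iff the vertices agree.
  endpoints-≟ : ∀ {y z} (p : Walk x₀ y) (q : Walk x₀ z) → Dec (y ≡ z)
  endpoints-≟ {y} {z} p q = map′ sound′ complete (cls iy ≟ cls iz)
    where
      T : Walk x₀ z
      T = p ++ʷ reverseʷ p ++ʷ q
      open FoldStem T
      iy iz : ℕ
      iy = after p oT
      iz = after T oT

      φiy : φ iy ≡ y
      φiy = traces-end φ p oT (traces-++ʷˡ φ p _ oT traces-T)

      sound′ : cls iy ≡ cls iz → y ≡ z
      sound′ e = trans (sym φiy) (trans (sound e) (traces-end φ T oT traces-T))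

      -- if y = z then p q⁻¹ ∈ H labels a folded loop γ, and γ T reads p again
      complete : y ≡ z → cls iy ≡ cls iz
      complete refl = F.deterministic≈ (proj₁ p′) (γ F.++ʷ proj₁ stem) refl same-word
        where
          p′ : Σ (F.Walk oT iy) λ γ → F.word γ ≡ word p
          p′ = segment p oT (darts-++ʷʳ loops T 0 ∘ darts-++ʷˡ p _ oT)
          γ-loop : Σ (F.Walk oT oT) λ γ → F.word γ ≈w word (p ++ʷ reverseʷ q)
          γ-loop = H-loop (to (generated _) (loop-word∈H (p ++ʷ reverseʷ q) ε))
          γ : F.Walk oT oT
          γ = proj₁ γ-loop
          a b : Word n
          a = word p
          b = word q
          T-word : word T ≡ a ++ invW a ++ b
          T-word = trans (word-++ʷ p _) (cong (a ++_) (trans (word-++ʷ (reverseʷ p) q) (cong (_++ b) (word-reverseʷ p))))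
          γ-word : F.word γ ≈w (a ++ invW b)
          γ-word = subst (F.word γ ≈w_) (trans (word-++ʷ p (reverseʷ q)) (cong (a ++_) (word-reverseʷ q))) (proj₂ γ-loop)
          same-word : F.word (proj₁ p′) ≈w F.word (γ F.++ʷ proj₁ stem)
          same-word = begin
            F.word (proj₁ p′)                                  ≡⟨ proj₂ p′ ⟩
            a                                                  ≈⟨ detour a b ⟨
            (a ++ invW b) ++ a ++ invW a ++ b                  ≈⟨ ≈w-++ʳ _ γ-word ⟨
            F.word γ ++ a ++ invW a ++ b                       ≡⟨ cong (F.word γ ++_) (trans (proj₂ stem) T-word) ⟨
            F.word γ ++ F.word (proj₁ stem)                    ≡⟨ F.word-++ʷ γ (proj₁ stem) ⟨
            F.word (γ F.++ʷ proj₁ stem)                        ∎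
            where open ≈w-Reasoning

module Backward {n : ℕ} (H : Word n → Set) (X : LGraph n) (imm : IsImmersion X)
                (x₀ : V X) (img : ∀ w → InImage X x₀ w ⇔ H w)
                (gs : List (Word n)) (generated : ∀ w → H w ⇔ Generated gs w)
                (no-swap : ∀ (x₁ x₂ : V X) → x₁ ≢ x₂ → ¬ Path (X ⊗ X) (x₁ , x₂) (x₂ , x₁)) where
  open FreeGroup {n}
  open Immersion X imm
  open Represents H x₀ img
  open Decide H X imm x₀ img gs generated

  record SquareLift (u h : Word n) : Set where
    constructor lift
    field
      {y z} : V X
      U     : Walk x₀ y
      H₁    : Walk y z
      H₂    : Walk z y
      U-word  : word U ≡ u
      H₁-word : word H₁ ≡ h
      H₂-word : word H₂ ≡ h

  square-lift : ∀ g u h → nf g ≡ conj u h → CyclicallyReduced h → H (g ++ g) → SquareLift u h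
  square-lift g u h nf-g h-cyc g²∈H with loop-for g²∈H
  ... | L , L≈g² with reduce L
  ... | L′ , L′-word with split u (h ++ h ++ invW u) L′ (trans L′-word nf-L)
    where
      -- the normal form of the word of L is u h h u⁻¹, already reduced
      nf-L : nf (word L) ≡ u ++ h ++ h ++ invW u
      nf-L = trans (≈w⇒nf≡ (L≈g² ◅◅ ≈w-++ (≈w-sym (nf-≈w g)) (≈w-sym (nf-≈w g))))
               (trans (cong (λ k → nf (k ++ k)) nf-g)
               (trans (≈w⇒nf≡ (conj-square u h)) (reduced⇒nf-id _ (square-reduced u h (subst Reduced nf-g (nf-reduced g)) h-cyc))))
  ... | y , U , rest , U-word , rest-word with split h (h ++ invW u) rest rest-word
  ... | z , H₁ , rest′ , H₁-word , rest′-word with split h (invW u) rest′ rest′-word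
  ... | y′ , H₂ , U′ , H₂-word , U′-word = record
    { U = U ; H₁ = H₁ ; H₂ = H₂ ++ʷ done (sym y≡y′) ; U-word = U-word ; H₁-word = H₁-word
    ; H₂-word = trans (word-++ʷ H₂ _) (trans (++-identityʳ _) H₂-word) }
    where
      -- reading u from x₀ and reading u⁻¹ backwards to x₀ both end at y ≡ y′
      y≡y′ : y ≡ y′
      y≡y′ = deterministic U (reverseʷ U′) refl
               (trans U-word (sym (trans (word-reverseʷ U′) (trans (cong invW U′-word) (invW-involutive u)))))

  -- On a lift, the h-walks either form a swapping path (excluded) or are
  -- loops, and then U H₁ U⁻¹ is a loop reading u h u⁻¹.
  conjugate∈H : ∀ {u h} g → nf g ≡ conj u h → SquareLift u h → H g
  conjugate∈H {u} {h} g nf-g (lift U H₁ H₂ U-word H₁-word H₂-word) with endpoints-≟ U (U ++ʷ H₁)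
  ... | no y≢z = ⊥-elim (no-swap _ _ y≢z (zip H₁ H₂ (trans H₁-word (sym H₂-word))))
  ... | yes refl = loop-word∈H (U ++ʷ H₁ ++ʷ reverseʷ U) loop≈g
    where
      loop≈g : word (U ++ʷ H₁ ++ʷ reverseʷ U) ≈w g
      loop≈g = begin
        word (U ++ʷ H₁ ++ʷ reverseʷ U)           ≡⟨ word-++ʷ U _ ⟩
        word U ++ word (H₁ ++ʷ reverseʷ U)       ≡⟨ cong (word U ++_) (word-++ʷ H₁ _) ⟩
        word U ++ word H₁ ++ word (reverseʷ U)   ≡⟨ cong₂ (λ a b → a ++ word H₁ ++ b) U-word (word-reverseʷ U) ⟩
        u ++ word H₁ ++ invW (word U)            ≡⟨ cong₂ (λ a b → u ++ a ++ invW b) H₁-word U-word ⟩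
        conj u h                                 ≡⟨ nf-g ⟨
        nf g                                     ≈⟨ nf-≈w g ⟩
        g                                        ∎
        where open ≈w-Reasoning

  -- if h is empty, g = u u⁻¹ is trivial; otherwise lift g²
  sqrt-closed : SqrtClosed H
  sqrt-closed g g²∈H with cyclic-decomposition (length (nf g)) (nf g) ≤-refl (nf-reduced g)
  ... | u , h , nf-g , inj₁ refl =
    loop-word∈H (done refl) (≈w-sym (≈w-sym (nf-≈w g) ◅◅ ≈w-reflexive nf-g ◅◅ inverseʳ u))
  ... | u , h , nf-g , inj₂ h-cyc = conjugate∈H g nf-g (square-lift g u h nf-g h-cyc g²∈H)

corollary4p4 : ∀ {n} (H : Word n → Set) → IsSubgroup H → FinitelyGenerated H →
    (X : LGraph n) → IsImmersion X → Connected X →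
    (x₀ : V X) → (∀ w → InImage X x₀ w ⇔ H w) →
    SqrtClosed H ⇔ (∀ (x₁ x₂ : V X) → x₁ ≢ x₂ → ¬ Path (X ⊗ X) (x₁ , x₂) (x₂ , x₁))
corollary4p4 H _ (gs , generated) X imm conn x₀ img =
  mk⇔ (Forward.no-swap H X imm conn x₀ img)
      (λ no-swap → Backward.sqrt-closed H X imm x₀ img gs generated no-swap)
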